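{- Let $G$ be a simple connected graph of order $n\geq 3$ with minimum degree $\delta(G)\geq 2$, and let $V=V(G)\subseteq V(R(G))$. If $S\subseteq V$ is a differential set of $R(G)$, then $S$ is a dominating set of $G$.
   Context: $R(G)$ is the graph obtained from $G$ by adding, for each edge $e=xy\in E(G)$, a new vertex $v_e$ adjacent exactly to $x$ and $y$. For a graph $H$ and $S\subseteq V(H)$, $B_H(S)$ is the set of vertices not in $S$ adjacent to some vertex of $S$, $\partial_H(S)=|B_H(S)|-|S|$, $\partial(H)=\max_{S\subseteq V(H)}\partial_H(S)$, and $S$ is a differential set of $H$ if $\partial_H(S)=\partial(H)$. A dominating set of $G$ is a set $S$ such that every vertex of $G$ is in $S$ or adjacent in $G$ to a vertex of $S$. -}

module Defs where

open import Data.Bool using (Bool; true; false; _∧_; _∨_; not; T)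
open import Data.Nat using (ℕ; _+_; _≤_; _<ᵇ_)
open import Data.Integer using (ℤ; +_; _-_) renaming (_≤_ to _≤ℤ_)
open import Data.Fin using (Fin; toℕ; _↑ˡ_; _↑ʳ_; splitAt)
open import Data.Fin.Properties using (_≟_)
open import Data.Fin.Subset using (Subset; _∈_; ∣_∣)
open import Data.Vec using (Vec; tabulate; _++_; replicate)
open import Data.List using (List; []; _∷_; length; lookup; filterᵇ; concatMap; allFin; map)
open import Data.Bool.ListAction using (any)
open import Data.Product using (_×_; _,_; proj₁; proj₂; ∃)
open import Data.Sum using (_⊎_; inj₁; inj₂)
open import Relation.Nullary.Decidable using (⌊_⌋)
open import Relation.Binary.PropositionalEquality using (_≡_)

record Graph : Set where
  field
    order : ℕ
    adj   : Fin order → Fin order → Bool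
open Graph public

Simple : Graph → Set
Simple G = (∀ x y → adj G x y ≡ adj G y x) × (∀ x → adj G x x ≡ false)

data Walk (G : Graph) : Fin (order G) → Fin (order G) → Set where
  here : ∀ {x} → Walk G x x
  step : ∀ {x y z} → T (adj G x y) → Walk G y z → Walk G x z

Connected : Graph → Set
Connected G = ∀ x y → Walk G x y

degree : (G : Graph) → Fin (order G) → ℕ
degree G v = ∣ tabulate (adj G v) ∣

MinDegreeAtLeast : ℕ → Graph → Set
MinDegreeAtLeast k G = ∀ v → k ≤ degree G v

edges : (G : Graph) → List (Fin (order G) × Fin (order G))
edges G = filterᵇ (λ p → (toℕ (proj₁ p) <ᵇ toℕ (proj₂ p)) ∧ adj G (proj₁ p) (proj₂ p))
                  (concatMap (λ x → map (λ y → (x , y)) (allFin (order G))) (allFin (order G)))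

numEdges : Graph → ℕ
numEdges G = length (edges G)

endpoint : (G : Graph) → Fin (order G) → Fin (order G) × Fin (order G) → Bool
endpoint G x (a , b) = ⌊ x ≟ a ⌋ ∨ ⌊ x ≟ b ⌋

-- R(G): vertices Fin (n + m); the first n are V(G) (via _↑ˡ_), the last m
-- are the new vertices v_e, one per edge e (via _↑ʳ_).
R : Graph → Graph
R G = record { order = order G + numEdges G ; adj = radj }
  where
  radj : Fin (order G + numEdges G) → Fin (order G + numEdges G) → Bool
  radj u w with splitAt (order G) u | splitAt (order G) w
  ... | inj₁ x | inj₁ y = adj G x y
  ... | inj₁ x | inj₂ e = endpoint G x (lookup (edges G) e)
  ... | inj₂ e | inj₁ y = endpoint G y (lookup (edges G) e)
  ... | inj₂ _ | inj₂ _ = false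

boundary : (H : Graph) → Subset (order H) → Subset (order H)
boundary H S = tabulate λ v →
  not (⌊ Data.Fin.Subset.Properties._∈?_ v S ⌋) ∧
  any (λ u → ⌊ Data.Fin.Subset.Properties._∈?_ u S ⌋ ∧ adj H u v) (allFin (order H))
  where import Data.Fin.Subset.Properties

diff : (H : Graph) → Subset (order H) → ℤ
diff H S = + ∣ boundary H S ∣ - + ∣ S ∣

DifferentialSet : (H : Graph) → Subset (order H) → Set
DifferentialSet H S = ∀ T → diff H T ≤ℤ diff H S

liftV : (G : Graph) → Subset (order G) → Subset (order (R G))
liftV G S = S ++ replicate (numEdges G) false

Dominating : (G : Graph) → Subset (order G) → Set
Dominating G S = ∀ v → v ∈ S ⊎ ∃ λ u → u ∈ S × T (adj G u v)

-- If v is not dominated by S, put v into S.  The set grows by one, but the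
-- boundary in R(G) grows by at least two: the subdivision vertices of two edges
-- at v (there are two since δ(G) ≥ 2) enter it, as neither endpoint lies in S,
-- and nothing leaves it, since v itself was not a boundary vertex.  So ∂ strictly
-- increases, contradicting the maximality of ∂ at S.
module Submission where

open import Defs
open import Data.Nat using (_≤_)
open import Data.Fin.Subset using (Subset)

open import Data.Bool using (Bool; false; T; _∧_)
open import Data.Bool.Properties using (T-∧; T-≡; T-∨)
open import Data.Empty using (⊥-elim)
open import Data.Nat using (suc; _+_; _<_; _<ᵇ_; s≤s)
import Data.Nat.Properties as ℕ
open import Data.Fin using (Fin; toℕ; zero; suc; _↑ˡ_; _↑ʳ_; splitAt)
import Data.Fin.Properties as Fin
open import Data.Fin.Subset as Sub using (_∈_; _∉_; _⊆_; _⊂_; ∣_∣; _∪_; ⁅_⁆; inside; outside)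
open import Data.Fin.Subset.Properties
  using (_∈?_; p⊆q⇒∣p∣≤∣q∣; p⊂q⇒∣p∣<∣q∣; ∣p∣≤∣x∷p∣; p⊆p∪q; q⊆p∪q; x∈p∪q⁻; ∉⊥; x∈⁅x⁆; x∈⁅y⁆⇒x≡y)
open import Data.Vec using (tabulate; _∷_; replicate; here; there)
import Data.Vec.Properties as Vec
open import Data.List using (lookup; allFin; map)
import Data.List.Relation.Unary.Any as Any
import Data.List.Relation.Unary.Any.Properties as Any
import Data.List.Membership.Propositional as List
import Data.List.Membership.Propositional.Properties as List
open import Data.Product as Product using (_×_; _,_; proj₁; proj₂; ∃)
open import Data.Sum as Sum using (_⊎_; inj₁; inj₂; [_,_]′)
open import Data.Integer using (+_; _-_; _⊖_) renaming (_<_ to _<ℤ_)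
import Data.Integer.Properties as ℤ
open import Function using (_∘_; id)
open import Function.Bundles using (_⇔_; mk⇔; Equivalence)
open import Relation.Nullary using (¬_; yes; no; contradiction)
open import Relation.Nullary.Decidable
  using (⌊_⌋; _×-dec_; toWitness; fromWitness; toWitnessFalse; fromWitnessFalse)
open import Relation.Nullary.Decidable.Core using (T?)
open import Relation.Binary using (tri<; tri≈; tri>)
open import Relation.Binary.PropositionalEquality using (_≡_; refl; sym; trans; cong; subst; _≢_)

∈-tabulate⇔ : ∀ {n} (f : Fin n → Bool) {i} → i ∈ tabulate f ⇔ T (f i)
∈-tabulate⇔ f {i} = mk⇔
  (λ i∈ → Equivalence.from T-≡ (trans (sym (Vec.lookup∘tabulate f i)) (Vec.[]=⇒lookup i∈)))
  (λ fi → Vec.lookup⇒[]= i _ (trans (Vec.lookup∘tabulate f i) (Equivalence.to T-≡ fi)))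

1≤∣p∣⇒Nonempty : ∀ {n} (p : Subset n) → 1 ≤ ∣ p ∣ → ∃ λ i → i ∈ p
1≤∣p∣⇒Nonempty (inside  ∷ p) _ = zero , here
1≤∣p∣⇒Nonempty (outside ∷ p) h with 1≤∣p∣⇒Nonempty p h
... | i , i∈p = suc i , there i∈p

2≤∣p∣⇒two-distinct-elements : ∀ {n} (p : Subset n) → 2 ≤ ∣ p ∣ →
                              ∃ λ i → ∃ λ j → i ≢ j × i ∈ p × j ∈ p
2≤∣p∣⇒two-distinct-elements (inside ∷ p) (s≤s h) with 1≤∣p∣⇒Nonempty p h
... | j , j∈p = zero , suc j , (λ ()) , here , there j∈p
2≤∣p∣⇒two-distinct-elements (outside ∷ p) h with 2≤∣p∣⇒two-distinct-elements p h
... | i , j , i≢j , i∈p , j∈p = suc i , suc j , i≢j ∘ Fin.suc-injective , there i∈p , there j∈p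

∣p∪⊥∣≤∣p∣ : ∀ {n} (p : Subset n) → ∣ p ∪ Sub.⊥ ∣ ≤ ∣ p ∣
∣p∪⊥∣≤∣p∣ p = p⊆q⇒∣p∣≤∣q∣ (λ x∈ → [ id , (λ x∈⊥ → contradiction x∈⊥ ∉⊥) ]′ (x∈p∪q⁻ p Sub.⊥ x∈))

∣p∪⁅x⁆∣≤1+∣p∣ : ∀ {n} (p : Subset n) x → ∣ p ∪ ⁅ x ⁆ ∣ ≤ suc ∣ p ∣
∣p∪⁅x⁆∣≤1+∣p∣ (inside  ∷ p) zero    = s≤s (ℕ.m≤n⇒m≤1+n (∣p∪⊥∣≤∣p∣ p))
∣p∪⁅x⁆∣≤1+∣p∣ (outside ∷ p) zero    = s≤s (∣p∪⊥∣≤∣p∣ p)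
∣p∪⁅x⁆∣≤1+∣p∣ (inside  ∷ p) (suc x) = s≤s (∣p∪⁅x⁆∣≤1+∣p∣ p x)
∣p∪⁅x⁆∣≤1+∣p∣ (outside ∷ p) (suc x) = ∣p∪⁅x⁆∣≤1+∣p∣ p x

p⊆q⇒2+∣p∣≤∣q∣ : ∀ {n} {p q : Subset n} {i j} → p ⊆ q → i ≢ j →
                i ∉ p → i ∈ q → j ∉ p → j ∈ q → 2 + ∣ p ∣ ≤ ∣ q ∣
p⊆q⇒2+∣p∣≤∣q∣ {p = p} {q} {i} {j} p⊆q i≢j i∉p i∈q j∉p j∈q =
  ℕ.≤-trans (s≤s (p⊂q⇒∣p∣<∣q∣ p⊂p∪i)) (p⊂q⇒∣p∣<∣q∣ p∪i⊂q)
  where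
  p⊂p∪i : p ⊂ p ∪ ⁅ i ⁆
  p⊂p∪i = p⊆p∪q ⁅ i ⁆ , i , q⊆p∪q p ⁅ i ⁆ (x∈⁅x⁆ i) , i∉p
  p∪i⊆q : p ∪ ⁅ i ⁆ ⊆ q
  p∪i⊆q x∈ with x∈p∪q⁻ p ⁅ i ⁆ x∈
  ... | inj₁ x∈p = p⊆q x∈p
  ... | inj₂ x∈i with x∈⁅y⁆⇒x≡y i x∈i
  ... | refl = i∈q
  j∉p∪i : j ∉ p ∪ ⁅ i ⁆
  j∉p∪i j∈ = [ j∉p , i≢j ∘ sym ∘ x∈⁅y⁆⇒x≡y i ]′ (x∈p∪q⁻ p ⁅ i ⁆ j∈)
  p∪i⊂q : p ∪ ⁅ i ⁆ ⊂ q
  p∪i⊂q = p∪i⊆q , j , j∈q , j∉p∪i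

diff-< : ∀ {b t b′ t′} → 2 + b ≤ b′ → t′ ≤ suc t → + b - + t <ℤ + b′ - + t′
diff-< {b} {t} {b′} {t′} b+2≤b′ t′≤t+1 = begin-strict
  + b - + t           ≡⟨ ℤ.m-n≡m⊖n b t ⟩
  b ⊖ t               <⟨ ℤ.⊖-monoˡ-< t (ℕ.n<1+n b) ⟩
  suc b ⊖ t           ≡⟨ ℤ.[1+m]⊖[1+n]≡m⊖n (suc b) t ⟨
  2 + b ⊖ suc t       ≤⟨ ℤ.⊖-monoˡ-≤ (suc t) b+2≤b′ ⟩
  b′ ⊖ suc t          ≤⟨ ℤ.⊖-monoʳ-≥-≤ b′ t′≤t+1 ⟩
  b′ ⊖ t′             ≡⟨ ℤ.m-n≡m⊖n b′ t′ ⟨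
  + b′ - + t′         ∎
  where open ℤ.≤-Reasoning

module _ (H : Graph) where

  Dominated-by : Subset (order H) → Fin (order H) → Set
  Dominated-by S w = ∃ λ u → u ∈ S × T (adj H u w)

  ∈-boundary⇔ : ∀ {S w} → w ∈ boundary H S ⇔ (w ∉ S × Dominated-by S w)
  ∈-boundary⇔ {S} {w} = mk⇔ to from
    where
    to : w ∈ boundary H S → w ∉ S × Dominated-by S w
    to w∈B with Equivalence.to T-∧ (Equivalence.to (∈-tabulate⇔ _) w∈B)
    ... | w∉S , adjacent with Any.satisfied (Any.any⁻ _ (allFin (order H)) adjacent)
    ... | u , u∈S∧uw = toWitnessFalse {a? = w ∈? S} w∉S , u ,
                       Product.map₁ (toWitness {a? = u ∈? S}) (Equivalence.to T-∧ u∈S∧uw)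
    from : w ∉ S × Dominated-by S w → w ∈ boundary H S
    from (w∉S , u , u∈S , uw) = Equivalence.from (∈-tabulate⇔ _) (Equivalence.from T-∧
      ( fromWitnessFalse {a? = w ∈? S} w∉S
      , Equivalence.to Any.any⇔ (Any.map (λ { refl → u∈S∧uw }) (List.∈-allFin u))))
      where
      u∈S∧uw : T (⌊ u ∈? S ⌋ ∧ adj H u w)
      u∈S∧uw = Equivalence.from T-∧ (fromWitness {a? = u ∈? S} u∈S , uw)

  boundary-⊆-∪⁅⁆ : ∀ {S w} → w ∉ boundary H S → boundary H S ⊆ boundary H (S ∪ ⁅ w ⁆)
  boundary-⊆-∪⁅⁆ {S} {w} w∉B {x} x∈B with Equivalence.to ∈-boundary⇔ x∈B
  ... | x∉S , u , u∈S , ux = Equivalence.from ∈-boundary⇔ (x∉S∪w , u , p⊆p∪q ⁅ w ⁆ u∈S , ux)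
    where
    x∉S∪w : x ∉ S ∪ ⁅ w ⁆
    x∉S∪w x∈ = [ x∉S , (λ x∈w → w∉B (subst (_∈ boundary H S) (x∈⁅y⁆⇒x≡y w x∈w) x∈B)) ]′
                 (x∈p∪q⁻ S ⁅ w ⁆ x∈)

T-endpoint⇔ : ∀ G {x : Fin (order G)} p → T (endpoint G x p) ⇔ (x ≡ proj₁ p ⊎ x ≡ proj₂ p)
T-endpoint⇔ G {x} (a , b) = mk⇔
  (Sum.map (toWitness {a? = x Fin.≟ a}) (toWitness {a? = x Fin.≟ b}) ∘ Equivalence.to T-∨)
  (Equivalence.from T-∨ ∘ Sum.map (fromWitness {a? = x Fin.≟ a}) (fromWitness {a? = x Fin.≟ b}))

module _ (G : Graph) where
  private
    n = order G
    m = numEdges G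

  -- e is the edge vy, so that n ↑ʳ e is its subdivision vertex in R(G).
  Joins : Fin m → Fin n → Fin n → Set
  Joins e v y = ∀ {x} → T (endpoint G x (lookup (edges G) e)) ⇔ (x ≡ v ⊎ x ≡ y)

  Joins-sym : ∀ {e v y} → Joins e v y → Joins e y v
  Joins-sym joins = mk⇔ (Sum.swap ∘ Equivalence.to joins) (Equivalence.from joins ∘ Sum.swap)

  ∈-edges : ∀ {a b} → toℕ a < toℕ b → T (adj G a b) → (a , b) List.∈ edges G
  ∈-edges {a} {b} a<b ab =
    List.∈-filter⁺ (λ p → T? ((toℕ (proj₁ p) <ᵇ toℕ (proj₂ p)) ∧ adj G (proj₁ p) (proj₂ p)))
      (List.∈-concatMap⁺ (λ x → map (x ,_) (allFin n))
        (Any.map (λ { refl → List.∈-map⁺ (a ,_) (List.∈-allFin b) }) (List.∈-allFin a)))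
      (Equivalence.from T-∧ (ℕ.<⇒<ᵇ a<b , ab))

  ∈-edges⇒Joins : ∀ {a b} → (a , b) List.∈ edges G → ∃ λ e → Joins e a b
  ∈-edges⇒Joins {a} {b} ab∈ = Any.index ab∈ ,
    subst (λ p → ∀ {x} → T (endpoint G x p) ⇔ (x ≡ a ⊎ x ≡ b)) (Any.lookup-index ab∈) (T-endpoint⇔ G _)

  adjacent⇒Joins : Simple G → ∀ {v y} → T (adj G v y) → ∃ λ e → Joins e v y
  adjacent⇒Joins (symmetric , irreflexive) {v} {y} vy with Fin.<-cmp v y
  ... | tri< v<y _ _ = ∈-edges⇒Joins (∈-edges v<y vy)
  ... | tri≈ _ refl _ = ⊥-elim (subst T (irreflexive v) vy)
  ... | tri> _ _ y<v with ∈-edges⇒Joins (∈-edges y<v (subst T (symmetric v y) vy))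
  ...   | e , joins = e , Joins-sym joins

  adjR-↑ˡ-↑ˡ : ∀ x y → adj (R G) (x ↑ˡ m) (y ↑ˡ m) ≡ adj G x y
  adjR-↑ˡ-↑ˡ x y rewrite Fin.splitAt-↑ˡ n x m | Fin.splitAt-↑ˡ n y m = refl

  adjR-↑ˡ-↑ʳ : ∀ x e → adj (R G) (x ↑ˡ m) (n ↑ʳ e) ≡ endpoint G x (lookup (edges G) e)
  adjR-↑ˡ-↑ʳ x e rewrite Fin.splitAt-↑ˡ n x m | Fin.splitAt-↑ʳ n m e = refl

  ↑ˡ-or-↑ʳ : (u : Fin (n + m)) → (∃ λ x → x ↑ˡ m ≡ u) ⊎ (∃ λ e → n ↑ʳ e ≡ u)
  ↑ˡ-or-↑ʳ u with splitAt n u in eq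
  ... | inj₁ x = inj₁ (x , Fin.splitAt⁻¹-↑ˡ eq)
  ... | inj₂ e = inj₂ (e , Fin.splitAt⁻¹-↑ʳ eq)

  ↑ʳ≢↑ˡ : ∀ e x → n ↑ʳ e ≢ x ↑ˡ m
  ↑ʳ≢↑ˡ e x eq with trans (sym (Fin.splitAt-↑ʳ n m e)) (trans (cong (splitAt n) eq) (Fin.splitAt-↑ˡ n x m))
  ... | ()

  ↑ʳ∉liftV : ∀ S e → n ↑ʳ e ∉ liftV G S
  ↑ʳ∉liftV S e e∈ with trans (sym (Vec.lookup-replicate e false))
                             (trans (sym (Vec.lookup-++ʳ S (replicate m false) e)) (Vec.[]=⇒lookup e∈))
  ... | ()

  ∈-liftV⁻ : ∀ S u → u ∈ liftV G S → ∃ λ x → u ≡ x ↑ˡ m × x ∈ S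
  ∈-liftV⁻ S u u∈ with ↑ˡ-or-↑ʳ u
  ... | inj₁ (x , refl) = x , refl ,
        Vec.lookup⇒[]= x S (trans (sym (Vec.lookup-++ˡ S (replicate m false) x)) (Vec.[]=⇒lookup u∈))
  ... | inj₂ (e , refl) = ⊥-elim (↑ʳ∉liftV S e u∈)

  module Undominated (S : Subset n) {v : Fin n} (v∉S : v ∉ S)
                     (undominated : ¬ Dominated-by G S v) where

    ↑ˡ∉boundary : v ↑ˡ m ∉ boundary (R G) (liftV G S)
    ↑ˡ∉boundary v∈B with Equivalence.to (∈-boundary⇔ (R G)) v∈B
    ... | _ , u , u∈S , uv with ∈-liftV⁻ S u u∈S
    ... | x , refl , x∈S = undominated (x , x∈S , subst T (adjR-↑ˡ-↑ˡ x v) uv)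

    ↑ʳ∉boundary : ∀ {e y} → Joins e v y → y ∉ S → n ↑ʳ e ∉ boundary (R G) (liftV G S)
    ↑ʳ∉boundary {e} joins y∉S e∈B with Equivalence.to (∈-boundary⇔ (R G)) e∈B
    ... | _ , u , u∈S , ue with ∈-liftV⁻ S u u∈S
    ... | x , refl , x∈S = [ (λ { refl → v∉S x∈S }) , (λ { refl → y∉S x∈S }) ]′
                             (Equivalence.to (joins {x}) (subst T (adjR-↑ˡ-↑ʳ x e) ue))

    ↑ʳ∈boundary-∪⁅↑ˡ⁆ : ∀ {e y} → Joins e v y → n ↑ʳ e ∈ boundary (R G) (liftV G S ∪ ⁅ v ↑ˡ m ⁆)
    ↑ʳ∈boundary-∪⁅↑ˡ⁆ {e} joins = Equivalence.from (∈-boundary⇔ (R G))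
      ( [ ↑ʳ∉liftV S e , ↑ʳ≢↑ˡ e v ∘ x∈⁅y⁆⇒x≡y (v ↑ˡ m) ]′ ∘ x∈p∪q⁻ (liftV G S) ⁅ v ↑ˡ m ⁆
      , v ↑ˡ m , q⊆p∪q (liftV G S) ⁅ v ↑ˡ m ⁆ (x∈⁅x⁆ (v ↑ˡ m))
      , subst T (sym (adjR-↑ˡ-↑ʳ v e)) (Equivalence.from joins (inj₁ refl)))

  2≤degree⇒two-neighbours : ∀ {v} → 2 ≤ degree G v →
                            ∃ λ y₁ → ∃ λ y₂ → y₁ ≢ y₂ × T (adj G v y₁) × T (adj G v y₂)
  2≤degree⇒two-neighbours {v} 2≤deg with 2≤∣p∣⇒two-distinct-elements (tabulate (adj G v)) 2≤deg
  ... | y₁ , y₂ , y₁≢y₂ , y₁∈N , y₂∈N = y₁ , y₂ , y₁≢y₂ , vy y₁∈N , vy y₂∈N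
    where
    vy : ∀ {y} → y ∈ tabulate (adj G v) → T (adj G v y)
    vy = Equivalence.to (∈-tabulate⇔ (adj G v))

  diff-<-∪-undominated : Simple G → MinDegreeAtLeast 2 G → ∀ S {v} → v ∉ S →
                         ¬ Dominated-by G S v →
                         diff (R G) (liftV G S) <ℤ diff (R G) (liftV G S ∪ ⁅ v ↑ˡ m ⁆)
  diff-<-∪-undominated simple@(symmetric , irreflexive) δ≥2 S {v} v∉S undominated
    with 2≤degree⇒two-neighbours (δ≥2 v)
  ... | y₁ , y₂ , y₁≢y₂ , vy₁ , vy₂ with adjacent⇒Joins simple vy₁ | adjacent⇒Joins simple vy₂
  ... | e₁ , joins₁ | e₂ , joins₂ =
    diff-< (p⊆q⇒2+∣p∣≤∣q∣ (boundary-⊆-∪⁅⁆ (R G) ↑ˡ∉boundary) e₁≢e₂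
             (↑ʳ∉boundary joins₁ (neighbour∉S vy₁)) (↑ʳ∈boundary-∪⁅↑ˡ⁆ joins₁)
             (↑ʳ∉boundary joins₂ (neighbour∉S vy₂)) (↑ʳ∈boundary-∪⁅↑ˡ⁆ joins₂))
           (∣p∪⁅x⁆∣≤1+∣p∣ (liftV G S) (v ↑ˡ m))
    where
    open Undominated S v∉S undominated
    neighbour∉S : ∀ {y} → T (adj G v y) → y ∉ S
    neighbour∉S vy y∈S = undominated (_ , y∈S , subst T (symmetric v _) vy)
    e₁≢e₂ : n ↑ʳ e₁ ≢ n ↑ʳ e₂
    e₁≢e₂ eq with Fin.↑ʳ-injective n e₁ e₂ eq
    ... | refl with Equivalence.to (joins₁ {y₂}) (Equivalence.from joins₂ (inj₂ refl))
    ... | inj₁ refl = subst T (irreflexive v) vy₂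
    ... | inj₂ refl = y₁≢y₂ refl

proposition2p6 : (G : Graph) → Simple G → Connected G → 3 ≤ order G →
    MinDegreeAtLeast 2 G → (S : Subset (order G)) →
    DifferentialSet (R G) (liftV G S) → Dominating G S
proposition2p6 G simple _ _ δ≥2 S differential v with v ∈? S
... | yes v∈S = inj₁ v∈S
... | no v∉S with Fin.any? (λ u → u ∈? S ×-dec T? (adj G u v))
...   | yes dominated = inj₂ dominated
...   | no undominated =
  ⊥-elim (ℤ.≤⇒≯ (differential (liftV G S ∪ ⁅ v ↑ˡ numEdges G ⁆))
                (diff-<-∪-undominated G simple δ≥2 S v∉S undominated))
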